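{- For every $k\ge 1$, $\chi_{CF\text{ - }CN}(K(2k+1,k))=2$.
   Context: The Kneser graph $K(n,k)$ has as vertices the $k$-element subsets of $\{1,\dots,n\}$, two being adjacent iff they are disjoint. A conflict-free closed neighborhood coloring of a graph $G$ with $m$ colors is a map $C:V(G)\to\{1,\dots,m\}$ such that for every vertex $v$ there is a color $i$ with $|N[v]\cap C^{ -1}(i)|=1$, where $N[v]=N(v)\cup\{v\}$. $\chi_{CF\text{ - }CN}(G)$ denotes the minimum such $m$. -}

module Defs where

open import Data.Nat using (ℕ; _<_)
open import Data.Fin using (Fin)
open import Data.Fin.Subset using (Subset; _∈_; _∉_; ∣_∣)
open import Data.Product using (Σ; ∃; _×_; proj₁)
open import Data.Sum using (_⊎_)
open import Relation.Nullary using (¬_)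
open import Relation.Binary.PropositionalEquality using (_≡_)

InClosedNbhd : {V : Set} → (V → V → Set) → V → V → Set
InClosedNbhd Adj v u = (u ≡ v) ⊎ Adj v u

-- C : V → Fin m is a conflict-free closed-neighbourhood colouring:
-- for every v there is a colour i such that |N[v] ∩ C⁻¹(i)| = 1,
-- i.e. there is some u ∈ N[v] with C u = i, and every w ∈ N[v] with C w = i is u.
IsCFCNColoring : {V : Set} → (V → V → Set) → (m : ℕ) → (V → Fin m) → Set
IsCFCNColoring {V} Adj m C =
  ∀ v → ∃ λ (i : Fin m) → ∃ λ (u : V) →
    (InClosedNbhd Adj v u × C u ≡ i) ×
    (∀ w → InClosedNbhd Adj v w → C w ≡ i → w ≡ u)

HasCFCNColoring : {V : Set} → (V → V → Set) → ℕ → Set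
HasCFCNColoring {V} Adj m = ∃ λ (C : V → Fin m) → IsCFCNColoring Adj m C

χCFCN≡ : {V : Set} → (V → V → Set) → ℕ → Set
χCFCN≡ Adj m = HasCFCNColoring Adj m × (∀ m' → m' < m → ¬ HasCFCNColoring Adj m')

KneserVertex : ℕ → ℕ → Set
KneserVertex n k = Σ (Subset n) (λ s → ∣ s ∣ ≡ k)

KneserAdj : {n k : ℕ} → KneserVertex n k → KneserVertex n k → Set
KneserAdj {n} u v = ∀ (x : Fin n) → x ∈ proj₁ u → x ∉ proj₁ v

module Submission where

-- Upper bound: fix distinct points a, b and colour a vertex 0 if it avoids
-- both, 1 otherwise.  In K(2k+1,k) the complement of a vertex v has k+1
-- points, so for y ∉ v the k-set ∁v - y is the UNIQUE neighbour of v
-- avoiding y; hence no neighbour of v avoids two points outside v.  So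
--   a, b ∈ v          : v is the only vertex of colour 1 in N[v];
--   x ∈ v, y ∉ v      : ∁v - y is the only vertex of colour 0 in N[v];
--   a, b ∉ v          : v is the only vertex of colour 0 in N[v].
-- Lower bound: in any graph, a vertex with a neighbour other than itself
-- sees its single colour twice.

open import Defs
open import Data.Nat using (ℕ; _≤_; _+_; _*_)
open import Data.Nat using (zero; suc; _∸_; _<_; z≤n; s≤s)
open import Data.Nat.Properties
  using (≤-reflexive; ≤-trans; m≤m+n; m+n∸m≡n; suc-injective; <⇒≢; <⇒≱; ≡-irrelevant)
open import Data.Nat.Tactic.RingSolver using (solve-∀)
open import Data.Fin using (Fin; zero; suc)
open import Data.Fin.Subset using (Subset; _∈_; _∉_; ∣_∣; _⊆_; ∁; ⊥; inside; outside; _-_; ⁅_⁆; Nonempty)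
open import Data.Fin.Subset.Properties
  using (_∈?_; nonempty?; Empty-unique; ∣⊥∣≡0; ∣∁p∣≡n∸∣p∣; p⊆q⇒∣p∣≤∣q∣; ⊆-antisym;
         x∈p⇒∣p-x∣<∣p∣; x∈p∧x≢y⇒x∈p-y; p─q⊆p; p─⊥≡p;
         x∈p⇒x∉∁p; x∉p⇒x∈∁p; x∈∁p⇒x∉p)
open import Data.Vec using (_∷_)
open import Data.Vec.Base using (here; there)
open import Data.Product using (Σ; ∃; _×_; _,_; proj₁; proj₂; swap)
open import Data.Sum using (inj₁; inj₂)
open import Function.Bundles using (_⇔_; mk⇔; Equivalence)
open import Relation.Nullary using (¬_; yes; no; contradiction)
open import Relation.Binary.PropositionalEquality
  using (_≡_; _≢_; refl; sym; trans; cong; subst; module ≡-Reasoning)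

open Equivalence using (to; from)

SeesOnce : {V : Set} → (V → V → Set) → {m : ℕ} → (V → Fin m) → V → Fin m → V → Set
SeesOnce Adj C v i u =
  (InClosedNbhd Adj v u × C u ≡ i) × (∀ w → InClosedNbhd Adj v w → C w ≡ i → w ≡ u)

fin1-unique : (i j : Fin 1) → i ≡ j
fin1-unique zero zero = refl

needsTwoColours : {V : Set} (Adj : V → V → Set) {v w : V} → Adj v w → w ≢ v →
                  ∀ m → m < 2 → ¬ HasCFCNColoring Adj m
needsTwoColours Adj {v} _ _ zero _ (C , _) with C v
... | ()
needsTwoColours Adj {v} {w} adj w≢v (suc zero) _ (C , isCF) with isCF v
... | _ , _ , _ , onlyOne =
  w≢v (trans (onlyOne w (inj₂ adj) (fin1-unique _ _)) (sym (onlyOne v (inj₁ refl) (fin1-unique _ _))))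
needsTwoColours Adj _ _ (suc (suc m)) (s≤s (s≤s ()))

∣p-x∣+1≡∣p∣ : ∀ {n} {p : Subset n} {x : Fin n} → x ∈ p → suc ∣ p - x ∣ ≡ ∣ p ∣
∣p-x∣+1≡∣p∣ {p = inside ∷ p}  here        = cong (λ q → suc ∣ q ∣) (p─⊥≡p p)
∣p-x∣+1≡∣p∣ {p = inside ∷ p}  (there x∈p) = cong suc (∣p-x∣+1≡∣p∣ x∈p)
∣p-x∣+1≡∣p∣ {p = outside ∷ p} (there x∈p) = ∣p-x∣+1≡∣p∣ x∈p

x∉p-x : ∀ {n} (p : Subset n) (x : Fin n) → x ∉ p - x
x∉p-x (_ ∷ p) zero    ()
x∉p-x (_ ∷ p) (suc x) (there x∈p-x) = x∉p-x p x x∈p-x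

-- A subset of t that is at least as large as t is t itself: a point of t
-- missing from w would give w ⊆ t - x, which is strictly smaller than t.
⊆-size-≡ : ∀ {n} {w t : Subset n} → w ⊆ t → ∣ t ∣ ≤ ∣ w ∣ → w ≡ t
⊆-size-≡ {w = w} {t} w⊆t ∣t∣≤∣w∣ = ⊆-antisym w⊆t t⊆w
  where
    t⊆w : t ⊆ w
    t⊆w {x} x∈t with x ∈? w
    ... | yes x∈w = x∈w
    ... | no  x∉w = contradiction (≤-trans ∣t∣≤∣w∣ (p⊆q⇒∣p∣≤∣q∣ w⊆t-x)) (<⇒≱ (x∈p⇒∣p-x∣<∣p∣ x∈t))
      where
        w⊆t-x : w ⊆ t - x
        w⊆t-x z∈w = x∈p∧x≢y⇒x∈p-y (w⊆t z∈w) (λ z≡x → x∉w (subst (_∈ w) z≡x z∈w))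

member-of-nonzero-size : ∀ {n} (p : Subset n) → 0 < ∣ p ∣ → Nonempty p
member-of-nonzero-size {n} p 0<∣p∣ with nonempty? p
... | yes p≠∅ = p≠∅
... | no  p=∅ = contradiction (trans (sym (∣⊥∣≡0 n)) (cong ∣_∣ (sym (Empty-unique p=∅)))) (<⇒≢ 0<∣p∣)

subset-of-size : ∀ n k → k ≤ n → Σ (Subset n) λ s → ∣ s ∣ ≡ k
subset-of-size n       zero    _         = ⊥ , ∣⊥∣≡0 n
subset-of-size (suc n) (suc k) (s≤s k≤n) with subset-of-size n k k≤n
... | s , ∣s∣≡k = inside ∷ s , cong suc ∣s∣≡k

2k+1≡k+[k+1] : ∀ k → 2 * k + 1 ≡ k + suc k
2k+1≡k+[k+1] = solve-∀

module OddKneser (k : ℕ) where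

  n : ℕ
  n = 2 * k + 1

  Vertex : Set
  Vertex = KneserVertex n k

  Adj : Vertex → Vertex → Set
  Adj = KneserAdj {n} {k}

  vertex-≡ : {u v : Vertex} → proj₁ u ≡ proj₁ v → u ≡ v
  vertex-≡ {s , _} {.s , _} refl = cong (s ,_) (≡-irrelevant _ _)

  ∣∁v∣≡k+1 : (v : Vertex) → ∣ ∁ (proj₁ v) ∣ ≡ suc k
  ∣∁v∣≡k+1 (s , ∣s∣≡k) = begin
    ∣ ∁ s ∣        ≡⟨ ∣∁p∣≡n∸∣p∣ s ⟩
    n ∸ ∣ s ∣      ≡⟨ cong (n ∸_) ∣s∣≡k ⟩
    n ∸ k          ≡⟨ cong (_∸ k) (2k+1≡k+[k+1] k) ⟩
    k + suc k ∸ k  ≡⟨ m+n∸m≡n k (suc k) ⟩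
    suc k          ∎
    where open ≡-Reasoning

  adj⇒⊆∁ : {v w : Vertex} → Adj v w → proj₁ w ⊆ ∁ (proj₁ v)
  adj⇒⊆∁ adj {x} x∈w = x∉p⇒x∈∁p (λ x∈v → adj x x∈v x∈w)

  complementWithout : (v : Vertex) (y : Fin n) → y ∉ proj₁ v → Vertex
  complementWithout v y y∉v =
    ∁ (proj₁ v) - y , suc-injective (trans (∣p-x∣+1≡∣p∣ (x∉p⇒x∈∁p y∉v)) (∣∁v∣≡k+1 v))

  complementWithout-adj : (v : Vertex) (y : Fin n) (y∉v : y ∉ proj₁ v) →
                          Adj v (complementWithout v y y∉v)
  complementWithout-adj v y _ x x∈v x∈u = x∈p⇒x∉∁p x∈v (p─q⊆p _ ⁅ y ⁆ x∈u)

  -- ... and it is the only neighbour of v avoiding y, since every such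
  -- neighbour is a k-subset of it.
  avoiding-neighbour-unique : {v w : Vertex} {y : Fin n} (y∉v : y ∉ proj₁ v) →
                              Adj v w → y ∉ proj₁ w → w ≡ complementWithout v y y∉v
  avoiding-neighbour-unique {v} {w} {y} y∉v adj y∉w =
    vertex-≡ (⊆-size-≡ w⊆∁v-y (≤-reflexive (trans (proj₂ (complementWithout v y y∉v)) (sym (proj₂ w)))))
    where
      w⊆∁v-y : proj₁ w ⊆ ∁ (proj₁ v) - y
      w⊆∁v-y z∈w = x∈p∧x≢y⇒x∈p-y (adj⇒⊆∁ {v} {w} adj z∈w) (λ z≡y → y∉w (subst (_∈ proj₁ w) z≡y z∈w))

  avoiding-neighbour-meets : {v w : Vertex} {x y : Fin n} → x ≢ y →
                             x ∉ proj₁ v → y ∉ proj₁ v → Adj v w → x ∉ proj₁ w → y ∈ proj₁ w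
  avoiding-neighbour-meets {v} {w} {y = y} x≢y x∉v y∉v adj x∉w =
    subst (λ u → y ∈ proj₁ u) (sym (avoiding-neighbour-unique {v} {w} x∉v adj x∉w))
          (x∈p∧x≢y⇒x∈p-y (x∉p⇒x∈∁p y∉v) (λ y≡x → x≢y (sym y≡x)))

  someVertex : Vertex
  someVertex = subset-of-size n k (≤-trans (m≤m+n k (k + 0)) (m≤m+n (2 * k) 1))

  vertexWithInAndOut : 1 ≤ k → Σ Vertex λ v → ∃ λ a → ∃ λ b → a ∈ proj₁ v × b ∉ proj₁ v
  vertexWithInAndOut 1≤k
    with member-of-nonzero-size (proj₁ someVertex) (subst (0 <_) (sym (proj₂ someVertex)) 1≤k)
       | member-of-nonzero-size (∁ (proj₁ someVertex)) (subst (0 <_) (sym (∣∁v∣≡k+1 someVertex)) (s≤s z≤n))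
  ... | a , a∈v | b , b∈∁v = someVertex , a , b , a∈v , x∈∁p⇒x∉p b∈∁v

  module PairColouring (a b : Fin n) (a≢b : a ≢ b) where

    colour : Vertex → Fin 2
    colour (s , _) with a ∈? s | b ∈? s
    ... | no _ | no _ = zero
    ... | _    | _    = suc zero

    Avoids : Fin n → Fin n → Vertex → Set
    Avoids x y w = x ∉ proj₁ w × y ∉ proj₁ w

    colour≡0⇔avoids : ∀ w → colour w ≡ zero ⇔ Avoids a b w
    colour≡0⇔avoids (s , _) with a ∈? s | b ∈? s
    ... | no a∉s  | no b∉s  = mk⇔ (λ _ → a∉s , b∉s) (λ _ → refl)
    ... | yes a∈s | _       = mk⇔ (λ ()) (λ (a∉s , _) → contradiction a∈s a∉s)
    ... | no _    | yes b∈s = mk⇔ (λ ()) (λ (_ , b∉s) → contradiction b∈s b∉s)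

    colour≡0⇔avoids′ : ∀ w → colour w ≡ zero ⇔ Avoids b a w
    colour≡0⇔avoids′ w = mk⇔ (λ c → swap (to (colour≡0⇔avoids w) c))
                             (λ av → from (colour≡0⇔avoids w) (swap av))

    -- a, b ∈ v: every neighbour avoids both, so only v has colour 1 in N[v].
    bothInside : (v : Vertex) → a ∈ proj₁ v → b ∈ proj₁ v → SeesOnce Adj colour v (colour v) v
    bothInside v a∈v b∈v = (inj₁ refl , refl) , onlyV
      where
        onlyV : ∀ w → InClosedNbhd Adj v w → colour w ≡ colour v → w ≡ v
        onlyV w (inj₁ w≡v) _    = w≡v
        onlyV w (inj₂ adj) same = contradiction a∈v (proj₁ (to (colour≡0⇔avoids v) colourV≡0))
          where
            colourV≡0 : colour v ≡ zero
            colourV≡0 = trans (sym same) (from (colour≡0⇔avoids w) (adj a a∈v , adj b b∈v))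

    oneInside : (x y : Fin n) → (∀ w → colour w ≡ zero ⇔ Avoids x y w) →
                (v : Vertex) → x ∈ proj₁ v → (y∉v : y ∉ proj₁ v) →
                SeesOnce Adj colour v zero (complementWithout v y y∉v)
    oneInside x y class₀ v x∈v y∉v =
      (inj₂ adjU , from (class₀ u) (adjU x x∈v , x∉p-x (∁ (proj₁ v)) y)) , onlyU
      where
        u : Vertex
        u = complementWithout v y y∉v
        adjU : Adj v u
        adjU = complementWithout-adj v y y∉v
        onlyU : ∀ w → InClosedNbhd Adj v w → colour w ≡ zero → w ≡ u
        onlyU w (inj₁ refl) c = contradiction x∈v (proj₁ (to (class₀ w) c))
        onlyU w (inj₂ adj)  c = avoiding-neighbour-unique {v} {w} y∉v adj (proj₂ (to (class₀ w) c))

    -- a, b ∉ v: v has colour 0 and no neighbour of v avoids both points.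
    noneInside : (v : Vertex) → a ∉ proj₁ v → b ∉ proj₁ v → SeesOnce Adj colour v zero v
    noneInside v a∉v b∉v = (inj₁ refl , from (colour≡0⇔avoids v) (a∉v , b∉v)) , onlyV
      where
        onlyV : ∀ w → InClosedNbhd Adj v w → colour w ≡ zero → w ≡ v
        onlyV w (inj₁ w≡v) _ = w≡v
        onlyV w (inj₂ adj) c with to (colour≡0⇔avoids w) c
        ... | a∉w , b∉w = contradiction (avoiding-neighbour-meets {v} {w} a≢b a∉v b∉v adj a∉w) b∉w

    colour-isCFCN : IsCFCNColoring Adj 2 colour
    colour-isCFCN v with a ∈? proj₁ v | b ∈? proj₁ v
    ... | yes a∈v | yes b∈v = colour v , v , bothInside v a∈v b∈v
    ... | yes a∈v | no  b∉v = zero , _ , oneInside a b colour≡0⇔avoids  v a∈v b∉v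
    ... | no  a∉v | yes b∈v = zero , _ , oneInside b a colour≡0⇔avoids′ v b∈v a∉v
    ... | no  a∉v | no  b∉v = zero , v , noneInside v a∉v b∉v

  twoColoursSuffice : 1 ≤ k → HasCFCNColoring Adj 2
  twoColoursSuffice 1≤k with vertexWithInAndOut 1≤k
  ... | v , a , b , a∈v , b∉v = colour , colour-isCFCN
    where open PairColouring a b (λ a≡b → b∉v (subst (_∈ proj₁ v) a≡b a∈v))

  -- Fewer do not: v and ∁v - b are distinct adjacent vertices (a lies only in v).
  twoColoursNeeded : 1 ≤ k → ∀ m → m < 2 → ¬ HasCFCNColoring Adj m
  twoColoursNeeded 1≤k with vertexWithInAndOut 1≤k
  ... | v , a , b , a∈v , b∉v = needsTwoColours Adj adjW w≢v
    where
      adjW : Adj v (complementWithout v b b∉v)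
      adjW = complementWithout-adj v b b∉v
      w≢v : complementWithout v b b∉v ≢ v
      w≢v w≡v = adjW a a∈v (subst (λ u → a ∈ proj₁ u) (sym w≡v) a∈v)

lemma9 : (k : ℕ) → 1 ≤ k → χCFCN≡ (KneserAdj {2 * k + 1} {k}) 2
lemma9 k 1≤k = twoColoursSuffice 1≤k , twoColoursNeeded 1≤k
  where open OddKneser k
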